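{- Let $T$ be a string of length $n$ and $1 \le i \le j < n$. For each $[s,t] \in \mathsf{MUS}(T[i..j+1])$ with $t \ne j+1$, if $[s,t] \notin \mathsf{MUS}(T[i..j])$ then $\#\mathit{occ}_{T[i..j+1]}(\mathit{sqs}_{i,j+1}) = 2$ and $\mathit{sqs}_{i,j+1}$ is a proper substring of $T[s..t]$.
   Context: For a string $W$, $W[a..b]$ is the substring from position $a$ to position $b$ (empty if $a>b$). For strings $w,W$, $\#\mathit{occ}_W(w)$ is the number of positions at which $w$ occurs in $W$, with $\#\mathit{occ}_W(\varepsilon)=|W|+1$. A substring $w$ of $W$ is unique in $W$ if $\#\mathit{occ}_W(w)=1$, repeating if $\#\mathit{occ}_W(w)\ge 2$, quasi-unique if $1\le\#\mathit{occ}_W(w)\le 2$. For $1\le i\le j\le n$, $\mathsf{MUS}(T[i..j])$ is the set of intervals $[s,t]$ with $i\le s\le t\le j$ (positions refer to $T$) such that $T[s..t]$ is unique in $T[i..j]$ and both $T[s+1..t]$ and $T[s..t-1]$ are repeating in $T[i..j]$. $\mathit{sqs}_{i,j}$ is the shortest non-empty suffix of $T[i..j]$ that is quasi-unique in $T[i..j]$. -}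

module Defs where

open import Data.Nat using (ℕ; zero; suc; _+_; _∸_; _≤_; _<_)
open import Data.Nat.Properties using (_≤?_)
open import Data.List using (List; []; _∷_; length; take; drop)
open import Data.List.Properties using (≡-dec)
open import Data.Product using (Σ; ∃; _×_; _,_)
open import Relation.Binary.PropositionalEquality using (_≡_)
open import Relation.Binary.Definitions using (DecidableEquality)
open import Relation.Nullary using (¬_; yes; no)

module Strings {A : Set} (_≟_ : DecidableEquality A) where

  -- W[a..b] with 1-based positions; empty if a > b
  sub : List A → ℕ → ℕ → List A
  sub W a b = take (suc b ∸ a) (drop (a ∸ 1) W)

  -- number of 0-based start positions p ≤ k at which w occurs in W
  countFrom : List A → List A → ℕ → ℕ
  countFrom W w zero with ≡-dec _≟_ (take (length w) W) w
  ... | yes _ = 1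
  ... | no  _ = 0
  countFrom W w (suc k) with ≡-dec _≟_ (take (length w) (drop (suc k) W)) w
  ... | yes _ = suc (countFrom W w k)
  ... | no  _ = countFrom W w k

  -- #occ_W(w): occurrences of w in W (|W|+1 for the empty string)
  occ : List A → List A → ℕ
  occ W w with length w ≤? length W
  ... | yes _ = countFrom W w (length W ∸ length w)
  ... | no  _ = 0

  Unique : List A → List A → Set
  Unique W w = occ W w ≡ 1

  Repeating : List A → List A → Set
  Repeating W w = 2 ≤ occ W w

  QuasiUnique : List A → List A → Set
  QuasiUnique W w = 1 ≤ occ W w × occ W w ≤ 2

  -- [s,t] ∈ MUS(T[i..j]) (positions of T, 1-based)
  InMUS : List A → ℕ → ℕ → ℕ → ℕ → Set
  InMUS T i j s t =
    i ≤ s × s ≤ t × t ≤ j ×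
    Unique (sub T i j) (sub T s t) ×
    Repeating (sub T i j) (sub T (suc s) t) ×
    Repeating (sub T i j) (sub T s (t ∸ 1))

  suffix : ℕ → List A → List A
  suffix k W = drop (length W ∸ k) W

  IsSqs : List A → List A → Set
  IsSqs W u = Σ ℕ λ k →
    1 ≤ k × k ≤ length W × u ≡ suffix k W ×
    QuasiUnique W u ×
    (∀ k' → 1 ≤ k' → k' < k → ¬ QuasiUnique W (suffix k' W))

  ProperSubstring : List A → List A → Set
  ProperSubstring u v = 1 ≤ occ v u × length u < length v

{-# OPTIONS --safe #-}
module Submission where

-- Let W = T[i..j] and V = T[i..j+1] = W c. Since t ≤ j, the factor w = T[s..t] is still unique
-- in W, so [s,t] can only leave the MUS set because one of T[s+1..t], T[s..t-1], call it x,
-- stops repeating. Every occurrence of x in V except one ending at the new letter c already lies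
-- in W; hence x is a suffix of V occurring at most twice, i.e. a quasi-unique suffix, and sqs,
-- being the shortest such suffix, is a suffix of x. Shifting the two occurrences of x (one
-- inside w, one at the end of V) shows that sqs occurs twice in V, and sqs lies inside x,
-- which is shorter than w.

open import Defs
open import Data.Nat using (ℕ; zero; suc; _+_; _∸_; _⊓_; _≤_; _<_; z≤n; s≤s; s≤s⁻¹; s<s⁻¹)
open import Data.Nat.Properties
open import Data.List using (List; []; _∷_; length; take; drop)
open import Data.List.Properties
  using (≡-dec; length-take; length-drop; take-take; take-[]; take-all; drop-drop)
open import Data.Product using (Σ; _×_; _,_; proj₁; proj₂)
open import Data.Sum using (_⊎_; inj₁; inj₂; [_,_]′; fromInj₁)
open import Data.Empty using (⊥-elim)
open import Relation.Binary.PropositionalEquality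
open import Relation.Binary.Definitions using (DecidableEquality)
open import Relation.Nullary using (¬_; Dec; yes; no)
open import Relation.Nullary.Decidable using (toSum)

private
  variable
    A : Set

∸-telescope : ∀ {a b c} → a ≤ b → b ≤ c → (b ∸ a) + (c ∸ b) ≡ c ∸ a
∸-telescope {a} {b} {c} a≤b b≤c = begin
  (b ∸ a) + (c ∸ b)  ≡⟨ +-comm (b ∸ a) (c ∸ b) ⟩
  (c ∸ b) + (b ∸ a)  ≡⟨ +-∸-assoc (c ∸ b) a≤b ⟨
  (c ∸ b) + b ∸ a    ≡⟨ cong (_∸ a) (m∸n+n≡m b≤c) ⟩
  c ∸ a              ∎
  where open ≡-Reasoning

n∸m<1+n∸m : ∀ {m n} → m ≤ n → n ∸ m < suc n ∸ m
n∸m<1+n∸m m≤n = ≤-reflexive (sym (+-∸-assoc 1 m≤n))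

drop-take : ∀ m n (xs : List A) → drop m (take n xs) ≡ take (n ∸ m) (drop m xs)
drop-take zero    n       xs       = refl
drop-take (suc m) zero    xs       = refl
drop-take (suc m) (suc n) []       = sym (take-[] (n ∸ m))
drop-take (suc m) (suc n) (x ∷ xs) = drop-take m n xs

take-take-≤ : ∀ {m n} (xs : List A) → m ≤ n → take m (take n xs) ≡ take m xs
take-take-≤ {m = m} {n} xs m≤n =
  trans (take-take m n xs) (cong (λ k → take k xs) (m≤n⇒m⊓n≡m m≤n))

length-take-≤ : ∀ n (xs : List A) → length (take n xs) ≤ n
length-take-≤ n xs = subst (_≤ n) (sym (length-take n xs)) (m⊓n≤m n (length xs))

length-take-≡ : ∀ {n} (xs : List A) → n ≤ length xs → length (take n xs) ≡ n
length-take-≡ {n = n} xs n≤∣xs∣ = trans (length-take n xs) (m≤n⇒m⊓n≡m n≤∣xs∣)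

take≡⇒length≤ : ∀ (w xs : List A) → take (length w) xs ≡ w → length w ≤ length xs
take≡⇒length≤ w xs e = m⊓n≡m⇒m≤n (trans (sym (length-take (length w) xs)) (cong length e))

take-drop-take : ∀ p m n (xs : List A) → p + m ≤ n →
                 take m (drop p (take n xs)) ≡ take m (drop p xs)
take-drop-take p m n xs p+m≤n = begin
  take m (drop p (take n xs))        ≡⟨ cong (take m) (drop-take p n xs) ⟩
  take m (take (n ∸ p) (drop p xs))  ≡⟨ take-take-≤ (drop p xs) m≤n∸p ⟩
  take m (drop p xs)                 ∎
  where
  open ≡-Reasoning
  m≤n∸p : m ≤ n ∸ p
  m≤n∸p = m+n≤o⇒m≤o∸n m (subst (_≤ n) (+-comm p m) p+m≤n)

module Occurrences {A : Set} (_≟_ : DecidableEquality A) where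
  open Strings _≟_

  -- Start positions are 0-based, as in countFrom. The empty word occurs at every p, even past
  -- the end of W, which is why most lemmas below ask for 1 ≤ length w.
  OccursAt : List A → List A → ℕ → Set
  OccursAt W w p = take (length w) (drop p W) ≡ w

  occursAt? : ∀ W w p → Dec (OccursAt W w p)
  occursAt? W w p = ≡-dec _≟_ (take (length w) (drop p W)) w

  occursAt⇒+≤ : ∀ {W w p} → 1 ≤ length w → OccursAt W w p → p + length w ≤ length W
  occursAt⇒+≤ {W} {w} {p} 1≤∣w∣ o =
    subst (_≤ length W) (+-comm (length w) p) (m≤o∸n⇒m+n≤o (length w) p≤∣W∣ ∣w∣≤∣W∣∸p)
    where
    ∣w∣≤∣W∣∸p : length w ≤ length W ∸ p
    ∣w∣≤∣W∣∸p = subst (length w ≤_) (length-drop p W) (take≡⇒length≤ w (drop p W) o)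
    p≤∣W∣ : p ≤ length W
    p≤∣W∣ = <⇒≤ (∸-cancelʳ-< {o = length W}
      (subst (_< length W ∸ p) (sym (n∸n≡0 (length W))) (≤-trans 1≤∣w∣ ∣w∣≤∣W∣∸p)))

  occursAt⇒≤∸ : ∀ {W w p} → 1 ≤ length w → OccursAt W w p → p ≤ length W ∸ length w
  occursAt⇒≤∸ {p = p} 1≤∣w∣ o = m+n≤o⇒m≤o∸n p (occursAt⇒+≤ 1≤∣w∣ o)

  countFrom-mono : ∀ {W W' w} k → (∀ p → p ≤ k → OccursAt W w p → OccursAt W' w p) →
                   countFrom W w k ≤ countFrom W' w k
  countFrom-mono {W} {W'} {w} zero f with occursAt? W w 0 | occursAt? W' w 0
  ... | yes _ | yes _  = ≤-refl
  ... | yes o | no ¬o′ = ⊥-elim (¬o′ (f 0 z≤n o))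
  ... | no _  | yes _  = z≤n
  ... | no _  | no _   = ≤-refl
  countFrom-mono {W} {W'} {w} (suc k) f with occursAt? W w (suc k) | occursAt? W' w (suc k)
  ... | yes _ | yes _  = s≤s (countFrom-mono k (λ p p≤k → f p (m≤n⇒m≤1+n p≤k)))
  ... | yes o | no ¬o′ = ⊥-elim (¬o′ (f (suc k) ≤-refl o))
  ... | no _  | yes _  = m≤n⇒m≤1+n (countFrom-mono k (λ p p≤k → f p (m≤n⇒m≤1+n p≤k)))
  ... | no _  | no _   = countFrom-mono k (λ p p≤k → f p (m≤n⇒m≤1+n p≤k))

  countFrom-≤-suc : ∀ {W W' w} p₀ k → (∀ p → p ≤ k → OccursAt W' w p → OccursAt W w p ⊎ p ≡ p₀) →
                    countFrom W' w k ≤ suc (countFrom W w k)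
  countFrom-≤-suc {W' = W'} {w} p₀ zero f with occursAt? W' w 0
  ... | yes _ = s≤s z≤n
  ... | no _  = z≤n
  countFrom-≤-suc {W} {W'} {w} p₀ (suc k) f with occursAt? W' w (suc k) | occursAt? W w (suc k)
  ... | yes _  | yes _ = s≤s (countFrom-≤-suc p₀ k (λ p p≤k → f p (m≤n⇒m≤1+n p≤k)))
  ... | no _   | yes _ = m≤n⇒m≤1+n (countFrom-≤-suc p₀ k (λ p p≤k → f p (m≤n⇒m≤1+n p≤k)))
  ... | no _   | no _  = countFrom-≤-suc p₀ k (λ p p≤k → f p (m≤n⇒m≤1+n p≤k))
  ... | yes o′ | no ¬o with f (suc k) ≤-refl o′
  ...   | inj₁ o    = ⊥-elim (¬o o)
  ...   | inj₂ refl = s≤s (countFrom-mono k λ p p≤k o →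
                        fromInj₁ (λ { refl → ⊥-elim (1+n≰n p≤k) }) (f p (m≤n⇒m≤1+n p≤k) o))

  countFrom<⇒occursAt : ∀ {W W' w} k → countFrom W w k < countFrom W' w k →
                        Σ ℕ λ p → OccursAt W' w p × ¬ OccursAt W w p
  countFrom<⇒occursAt {W} {W'} {w} zero lt with occursAt? W w 0 | occursAt? W' w 0
  ... | yes _ | yes _ = ⊥-elim (n≮n 1 lt)
  ... | yes _ | no _  = ⊥-elim (n≮0 lt)
  ... | no ¬o | yes o = 0 , o , ¬o
  ... | no _  | no _  = ⊥-elim (n≮n 0 lt)
  countFrom<⇒occursAt {W} {W'} {w} (suc k) lt with occursAt? W w (suc k) | occursAt? W' w (suc k)
  ... | no ¬o | yes o = suc k , o , ¬o
  ... | yes _ | yes _ = countFrom<⇒occursAt k (s<s⁻¹ lt)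
  ... | yes _ | no _  = countFrom<⇒occursAt k (<-trans (n<1+n _) lt)
  ... | no _  | no _  = countFrom<⇒occursAt k lt

  occursAt⇒1≤countFrom : ∀ {W w p} k → p ≤ k → OccursAt W w p → 1 ≤ countFrom W w k
  occursAt⇒1≤countFrom {W} {w} zero p≤k o with occursAt? W w 0
  ... | yes _ = ≤-refl
  occursAt⇒1≤countFrom {W} {w} zero z≤n o | no ¬o = ⊥-elim (¬o o)
  occursAt⇒1≤countFrom {W} {w} (suc k) p≤k o with occursAt? W w (suc k)
  ... | yes _ = s≤s z≤n
  ... | no ¬o = occursAt⇒1≤countFrom k (s≤s⁻¹ (≤∧≢⇒< p≤k λ { refl → ¬o o })) o

  occursAt²⇒2≤countFrom : ∀ {W w p q} k → p < q → q ≤ k → OccursAt W w p → OccursAt W w q →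
                          2 ≤ countFrom W w k
  occursAt²⇒2≤countFrom zero p<q z≤n _ _ = ⊥-elim (n≮0 p<q)
  occursAt²⇒2≤countFrom {W} {w} (suc k) p<q q≤k o o′ with occursAt? W w (suc k)
  ... | yes _ = s≤s (occursAt⇒1≤countFrom k (s≤s⁻¹ (≤-trans p<q q≤k)) o)
  ... | no ¬o = occursAt²⇒2≤countFrom k p<q (s≤s⁻¹ (≤∧≢⇒< q≤k λ { refl → ¬o o′ })) o o′

  countFrom-stable : ∀ {W w k} k′ → (∀ p → OccursAt W w p → p ≤ k) → k ≤ k′ →
                     countFrom W w k′ ≡ countFrom W w k
  countFrom-stable zero _ z≤n = refl
  countFrom-stable {W} {w} (suc k′) bound k≤1+k′ with m≤n⇒m<n∨m≡n k≤1+k′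
  ... | inj₂ refl = refl
  ... | inj₁ (s≤s k≤k′) with occursAt? W w (suc k′)
  ...   | yes o = ⊥-elim (1+n≰n (≤-trans (bound (suc k′) o) k≤k′))
  ...   | no _  = countFrom-stable k′ bound k≤k′

  countFrom≡0 : ∀ {W w} k → (∀ p → ¬ OccursAt W w p) → countFrom W w k ≡ 0
  countFrom≡0 {W} {w} zero none with occursAt? W w 0
  ... | yes o = ⊥-elim (none 0 o)
  ... | no _  = refl
  countFrom≡0 {W} {w} (suc k) none with occursAt? W w (suc k)
  ... | yes o = ⊥-elim (none (suc k) o)
  ... | no _  = countFrom≡0 k none

  occ≡countFrom : ∀ W w k → 1 ≤ length w → length W ∸ length w ≤ k → occ W w ≡ countFrom W w k
  occ≡countFrom W w k 1≤∣w∣ bound with length w ≤? length W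
  ... | yes _   = sym (countFrom-stable k (λ p → occursAt⇒≤∸ {W} {w} {p} 1≤∣w∣) bound)
  ... | no w≰W = sym (countFrom≡0 k λ p o → w≰W (m+n≤o⇒n≤o p (occursAt⇒+≤ {W} {w} {p} 1≤∣w∣ o)))

  occ-[] : ∀ W → occ W [] ≡ suc (length W)
  occ-[] W = countFrom-[] (length W)
    where
    countFrom-[] : ∀ k → countFrom W [] k ≡ suc k
    countFrom-[] zero    = refl
    countFrom-[] (suc k) = cong suc (countFrom-[] k)

  module _ {W W' w : List A} (1≤∣w∣ : 1 ≤ length w) where
    private
      k : ℕ
      k = length W + length W'
      occ-W : occ W w ≡ countFrom W w k
      occ-W = occ≡countFrom W w k 1≤∣w∣
        (≤-trans (m∸n≤m (length W) (length w)) (m≤m+n (length W) (length W')))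
      occ-W' : occ W' w ≡ countFrom W' w k
      occ-W' = occ≡countFrom W' w k 1≤∣w∣
        (≤-trans (m∸n≤m (length W') (length w)) (m≤n+m (length W') (length W)))

    occ-mono : (∀ p → OccursAt W w p → OccursAt W' w p) → occ W w ≤ occ W' w
    occ-mono f = subst₂ _≤_ (sym occ-W) (sym occ-W') (countFrom-mono k (λ p _ → f p))

    occ-≤-suc : ∀ p₀ → (∀ p → OccursAt W' w p → OccursAt W w p ⊎ p ≡ p₀) →
                occ W' w ≤ suc (occ W w)
    occ-≤-suc p₀ f =
      subst₂ (λ a b → a ≤ suc b) (sym occ-W') (sym occ-W) (countFrom-≤-suc p₀ k (λ p _ → f p))

    occ<⇒occursAt : occ W w < occ W' w → Σ ℕ λ p → OccursAt W' w p × ¬ OccursAt W w p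
    occ<⇒occursAt lt = countFrom<⇒occursAt k (subst₂ _<_ occ-W occ-W' lt)

  occursAt⇒1≤occ : ∀ {W w} p → 1 ≤ length w → OccursAt W w p → 1 ≤ occ W w
  occursAt⇒1≤occ {W} {w} p 1≤∣w∣ o = subst (1 ≤_) (sym (occ≡countFrom W w _ 1≤∣w∣ ≤-refl))
    (occursAt⇒1≤countFrom _ (occursAt⇒≤∸ {W} {w} {p} 1≤∣w∣ o) o)

  occursAt²⇒repeating : ∀ {W w} p q → 1 ≤ length w → p < q →
                        OccursAt W w p → OccursAt W w q → Repeating W w
  occursAt²⇒repeating {W} {w} p q 1≤∣w∣ p<q o o′ = subst (2 ≤_) (sym (occ≡countFrom W w _ 1≤∣w∣ ≤-refl))
    (occursAt²⇒2≤countFrom _ p<q (occursAt⇒≤∸ {W} {w} {q} 1≤∣w∣ o′) o o′)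

  ¬repeating⇒nonempty : ∀ {W x} → 1 ≤ length W → ¬ Repeating W x → 1 ≤ length x
  ¬repeating⇒nonempty {W} {[]}    1≤∣W∣ ¬rep = ⊥-elim (¬rep (subst (2 ≤_) (sym (occ-[] W)) (s≤s 1≤∣W∣)))
  ¬repeating⇒nonempty {x = _ ∷ _} _     _    = s≤s z≤n

  occursAt-take⁺ : ∀ {V w} p n → p + length w ≤ n → OccursAt V w p → OccursAt (take n V) w p
  occursAt-take⁺ {V} {w} p n fits o = trans (take-drop-take p (length w) n V fits) o

  occursAt-take⁻ : ∀ {V w} p n → 1 ≤ length w → OccursAt (take n V) w p →
                   p + length w ≤ n × OccursAt V w p
  occursAt-take⁻ {V} {w} p n 1≤∣w∣ o = fits , trans (sym (take-drop-take p (length w) n V fits)) o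
    where
    fits : p + length w ≤ n
    fits = ≤-trans (occursAt⇒+≤ {take n V} {w} {p} 1≤∣w∣ o) (length-take-≤ n V)

  occ-take-≤ : ∀ {V w} n → 1 ≤ length w → occ (take n V) w ≤ occ V w
  occ-take-≤ {V} {w} n 1≤∣w∣ =
    occ-mono {take n V} {V} {w} 1≤∣w∣ (λ p o → proj₂ (occursAt-take⁻ {V} {w} p n 1≤∣w∣ o))

  occursAt-drop⁺ : ∀ {V w} q p → OccursAt V w (q + p) → OccursAt (drop q V) w p
  occursAt-drop⁺ {V} {w} q p o = trans (cong (take (length w)) (drop-drop q p V)) o

  take-occursAt : ∀ m (xs : List A) → OccursAt xs (take m xs) 0
  take-occursAt m xs = begin
    take (length (take m xs)) xs  ≡⟨ cong (λ k → take k xs) (length-take m xs) ⟩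
    take (m ⊓ length xs) xs       ≡⟨ take-take m (length xs) xs ⟨
    take m (take (length xs) xs)  ≡⟨ cong (take m) (take-all (length xs) xs ≤-refl) ⟩
    take m xs                     ∎
    where open ≡-Reasoning

  drop-occursAt : ∀ d (xs : List A) → OccursAt xs (drop d xs) d
  drop-occursAt d xs = take-all (length (drop d xs)) (drop d xs) ≤-refl

  occursAt-trans : ∀ {V w x} p c → 1 ≤ length x →
                   OccursAt V w p → OccursAt w x c → OccursAt V x (p + c)
  occursAt-trans {V} {w} {x} p c 1≤∣x∣ o o′ = begin
    take (length x) (drop (p + c) V)
      ≡⟨ cong (take (length x)) (drop-drop p c V) ⟨
    take (length x) (drop c (drop p V))
      ≡⟨ take-drop-take c (length x) (length w) (drop p V) (occursAt⇒+≤ {w} {x} {c} 1≤∣x∣ o′) ⟨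
    take (length x) (drop c (take (length w) (drop p V)))
      ≡⟨ cong (λ v → take (length x) (drop c v)) o ⟩
    take (length x) (drop c w)
      ≡⟨ o′ ⟩
    x ∎
    where open ≡-Reasoning

  length-sub : ∀ T {i j} → 1 ≤ i → j ≤ length T → length (sub T i j) ≡ suc j ∸ i
  length-sub T {suc i} {j} _ j≤∣T∣ =
    length-take-≡ (drop i T) (subst (j ∸ i ≤_) (sym (length-drop i T)) (∸-monoˡ-≤ i j≤∣T∣))

  sub-prefix : ∀ T i {j j′} → j ≤ j′ → sub T i j ≡ take (suc j ∸ i) (sub T i j′)
  sub-prefix T i j≤j′ = sym (take-take-≤ _ (∸-monoˡ-≤ i (s≤s j≤j′)))

  sub-occursAt : ∀ T {i j s t} → 1 ≤ i → i ≤ s → s ≤ suc t → t ≤ j →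
                 OccursAt (sub T i j) (sub T s t) (s ∸ i)
  sub-occursAt T {suc i} {j} {suc s} {t} _ (s≤s i≤s) (s≤s s≤t) t≤j =
    occursAt-take⁺ (s ∸ i) (j ∸ i) fits (occursAt-drop⁺ i (s ∸ i)
      (subst (OccursAt T w) (sym (m+[n∸m]≡n i≤s)) (take-occursAt (t ∸ s) (drop s T))))
    where
    w = sub T (suc s) t
    fits : (s ∸ i) + length w ≤ j ∸ i
    fits = begin
      (s ∸ i) + length w  ≤⟨ +-monoʳ-≤ (s ∸ i) (length-take-≤ (t ∸ s) (drop s T)) ⟩
      (s ∸ i) + (t ∸ s)   ≡⟨ ∸-telescope i≤s s≤t ⟩
      t ∸ i               ≤⟨ ∸-monoˡ-≤ i t≤j ⟩
      j ∸ i               ∎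
      where open ≤-Reasoning

  sub-trimˡ : ∀ T {s t} → 1 ≤ s → s ≤ t → t < length T →
              OccursAt (sub T s t) (sub T (suc s) t) (suc s ∸ s) ×
              length (sub T (suc s) t) < length (sub T s t)
  sub-trimˡ T {s} {t} 1≤s s≤t t<∣T∣ = sub-occursAt T 1≤s (n≤1+n s) (s≤s s≤t) ≤-refl , shorter
    where
    shorter : length (sub T (suc s) t) < length (sub T s t)
    shorter = begin-strict
      length (sub T (suc s) t)  ≤⟨ length-take-≤ (t ∸ s) (drop s T) ⟩
      t ∸ s                     <⟨ n∸m<1+n∸m s≤t ⟩
      suc t ∸ s                 ≡⟨ length-sub T 1≤s (<⇒≤ t<∣T∣) ⟨
      length (sub T s t)        ∎
      where open ≤-Reasoning

  sub-trimʳ : ∀ T {s t} → 1 ≤ s → s ≤ t → t < length T →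
              OccursAt (sub T s t) (sub T s (t ∸ 1)) (s ∸ s) ×
              length (sub T s (t ∸ 1)) < length (sub T s t)
  sub-trimʳ T {t = zero} (s≤s _) () _
  sub-trimʳ T {s} {suc t} 1≤s s≤1+t 1+t<∣T∣ = sub-occursAt T 1≤s ≤-refl s≤1+t (n≤1+n t) , shorter
    where
    shorter : length (sub T s t) < length (sub T s (suc t))
    shorter = begin-strict
      length (sub T s t)        ≤⟨ length-take-≤ (suc t ∸ s) (drop (s ∸ 1) T) ⟩
      suc t ∸ s                 <⟨ n∸m<1+n∸m s≤1+t ⟩
      suc (suc t) ∸ s           ≡⟨ length-sub T 1≤s (<⇒≤ 1+t<∣T∣) ⟨
      length (sub T s (suc t))  ∎
      where open ≤-Reasoning

  length-suffix : ∀ {k} (xs : List A) → k ≤ length xs → length (suffix k xs) ≡ k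
  length-suffix {k} xs k≤∣xs∣ = trans (length-drop (length xs ∸ k) xs) (m∸[m∸n]≡n k≤∣xs∣)

  suffix-nonempty : ∀ {k} (xs : List A) → 1 ≤ k → k ≤ length xs → 1 ≤ length (suffix k xs)
  suffix-nonempty xs 1≤k k≤∣xs∣ = subst (1 ≤_) (sym (length-suffix xs k≤∣xs∣)) 1≤k

  suffix-suffix : ∀ {k m} (xs : List A) → k ≤ m → m ≤ length xs →
                  suffix k (suffix m xs) ≡ suffix k xs
  suffix-suffix {k} {m} xs k≤m m≤∣xs∣ = begin
    suffix k (drop (length xs ∸ m) xs)
      ≡⟨ cong (λ l → drop (l ∸ k) (drop (length xs ∸ m) xs)) (length-suffix xs m≤∣xs∣) ⟩
    drop (m ∸ k) (drop (length xs ∸ m) xs)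
      ≡⟨ drop-drop (length xs ∸ m) (m ∸ k) xs ⟩
    drop ((length xs ∸ m) + (m ∸ k)) xs
      ≡⟨ cong (λ l → drop l xs) (trans (+-comm (length xs ∸ m) (m ∸ k)) (∸-telescope k≤m m≤∣xs∣)) ⟩
    drop (length xs ∸ k) xs ∎
    where open ≡-Reasoning

  occursAt-end⇒suffix : ∀ {V x} → length x ≤ length V → OccursAt V x (length V ∸ length x) →
                        x ≡ suffix (length x) V
  occursAt-end⇒suffix {V} {x} ∣x∣≤∣V∣ o =
    trans (sym o) (take-all (length x) (suffix (length x) V) (≤-reflexive (length-suffix V ∣x∣≤∣V∣)))

  occursAt-extension : ∀ {V x} n p → length V ≡ suc n → 1 ≤ length x → OccursAt V x p →
                       OccursAt (take n V) x p ⊎ p ≡ length V ∸ length x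
  occursAt-extension {V} {x} n p ∣V∣≡1+n 1≤∣x∣ o with p + length x ≤? n
  ... | yes fits = inj₁ (occursAt-take⁺ {V} {x} p n fits o)
  ... | no ¬fits = inj₂ (begin
    p                        ≡⟨ m+n∸n≡m p (length x) ⟨
    p + length x ∸ length x  ≡⟨ cong (_∸ length x) ends ⟩
    length V ∸ length x      ∎)
    where
    open ≡-Reasoning
    ends : p + length x ≡ length V
    ends = ≤-antisym (occursAt⇒+≤ {V} {x} {p} 1≤∣x∣ o)
                     (subst (_≤ p + length x) (sym ∣V∣≡1+n) (≰⇒> ¬fits))

  lostRepeat⇒quasiUniqueSuffix : ∀ {V x} n → length V ≡ suc n → 1 ≤ length x →
                                 Repeating V x → ¬ Repeating (take n V) x →
                                 x ≡ suffix (length x) V × QuasiUnique V x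
  lostRepeat⇒quasiUniqueSuffix {V} {x} n ∣V∣≡1+n 1≤∣x∣ rep ¬rep′ =
    isSuffix , ≤-trans (s≤s z≤n) rep , atMostTwice
    where
    W = take n V
    end = length V ∸ length x
    extension : ∀ p → OccursAt V x p → OccursAt W x p ⊎ p ≡ end
    extension p = occursAt-extension {V} {x} n p ∣V∣≡1+n 1≤∣x∣
    atMostOnce : occ W x ≤ 1
    atMostOnce = s≤s⁻¹ (≰⇒> ¬rep′)
    atMostTwice : occ V x ≤ 2
    atMostTwice = ≤-trans (occ-≤-suc {W} {V} {x} 1≤∣x∣ end extension) (s≤s atMostOnce)
    isSuffix : x ≡ suffix (length x) V
    isSuffix with occ<⇒occursAt {W} {V} {x} 1≤∣x∣ (<-≤-trans (s≤s atMostOnce) rep)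
    ... | p , o , ¬o′ with extension p o
    ...   | inj₁ o′   = ⊥-elim (¬o′ o′)
    ...   | inj₂ refl = occursAt-end⇒suffix (m+n≤o⇒n≤o end (occursAt⇒+≤ {V} {x} {end} 1≤∣x∣ o)) o

  sqs-suffixOf : ∀ {V x u} → IsSqs V u → 1 ≤ length x → x ≡ suffix (length x) V → QuasiUnique V x →
                 Σ ℕ λ k → 1 ≤ k × k ≤ length x × u ≡ suffix k x
  sqs-suffixOf {V} {x} {u} (k , 1≤k , _ , u≡ , _ , shortest) 1≤∣x∣ x≡ quasi =
    k , 1≤k , k≤∣x∣ , (begin
      u                               ≡⟨ u≡ ⟩
      suffix k V                      ≡⟨ suffix-suffix V k≤∣x∣ ∣x∣≤∣V∣ ⟨
      suffix k (suffix (length x) V)  ≡⟨ cong (suffix k) x≡ ⟨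
      suffix k x                      ∎)
    where
    open ≡-Reasoning
    ∣x∣≤∣V∣ : length x ≤ length V
    ∣x∣≤∣V∣ = subst (_≤ length V) (sym (trans (cong length x≡) (length-drop (length V ∸ length x) V)))
                    (m∸n≤m (length V) (length V ∸ length x))
    k≤∣x∣ : k ≤ length x
    k≤∣x∣ = ≮⇒≥ λ ∣x∣<k → shortest (length x) 1≤∣x∣ ∣x∣<k (subst (QuasiUnique V) x≡ quasi)

  suffix-repeating : ∀ {V x} k b p → 1 ≤ k → k ≤ length x → b < p →
                     OccursAt V x b → OccursAt V x p → Repeating V (suffix k x)
  suffix-repeating {V} {x} k b p 1≤k k≤∣x∣ b<p o o′ =
    occursAt²⇒repeating {V} (b + d) (p + d) 1≤∣u∣ (+-monoˡ-< d b<p) (shifted b o) (shifted p o′)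
    where
    d = length x ∸ k
    1≤∣u∣ : 1 ≤ length (suffix k x)
    1≤∣u∣ = suffix-nonempty x 1≤k k≤∣x∣
    shifted : ∀ q → OccursAt V x q → OccursAt V (suffix k x) (q + d)
    shifted q oq = occursAt-trans {V} {x} q d 1≤∣u∣ oq (drop-occursAt d x)

  suffix-properSubstring : ∀ {w x} k c → 1 ≤ k → k ≤ length x →
                           OccursAt w x c → length x < length w → ProperSubstring (suffix k x) w
  suffix-properSubstring {w} {x} k c 1≤k k≤∣x∣ o ∣x∣<∣w∣ =
    occursAt⇒1≤occ {w} (c + d) 1≤∣u∣ (occursAt-trans {w} {x} c d 1≤∣u∣ o (drop-occursAt d x)) ,
    ≤-<-trans (≤-trans (≤-reflexive (length-suffix x k≤∣x∣)) k≤∣x∣) ∣x∣<∣w∣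
    where
    d = length x ∸ k
    1≤∣u∣ : 1 ≤ length (suffix k x)
    1≤∣u∣ = suffix-nonempty x 1≤k k≤∣x∣

  unique-prefix : ∀ {V W w} n a → 1 ≤ length w → W ≡ take n V →
                  OccursAt W w a → Unique V w → Unique W w
  unique-prefix {V} {w = w} n a 1≤∣w∣ refl o unique =
    ≤-antisym (subst (occ (take n V) w ≤_) unique (occ-take-≤ {V} {w} n 1≤∣w∣))
              (occursAt⇒1≤occ {take n V} a 1≤∣w∣ o)

  lostRepeat⇒sqs-twice-inside : ∀ {V W w x u} n a c → 1 ≤ n → length V ≡ suc n → W ≡ take n V →
                                OccursAt W w a → OccursAt w x c → length x < length w →
                                Repeating V x → ¬ Repeating W x → IsSqs V u →
                                occ V u ≡ 2 × ProperSubstring u w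
  lostRepeat⇒sqs-twice-inside {V} {W} {w} {x} {u} n a c 1≤n ∣V∣≡1+n refl w-in-W x-in-w ∣x∣<∣w∣
                              rep ¬rep′ sqs@(_ , _ , _ , _ , (_ , u-atMostTwice) , _) =
    conclude (sqs-suffixOf sqs 1≤∣x∣ x-suffix x-quasiUnique)
    where
    1≤∣x∣ : 1 ≤ length x
    1≤∣x∣ = ¬repeating⇒nonempty {W} {x}
      (subst (1 ≤_) (sym (length-take-≡ V (subst (n ≤_) (sym ∣V∣≡1+n) (n≤1+n n)))) 1≤n) ¬rep′
    x-suffix : x ≡ suffix (length x) V
    x-suffix = proj₁ (lostRepeat⇒quasiUniqueSuffix {V} {x} n ∣V∣≡1+n 1≤∣x∣ rep ¬rep′)
    x-quasiUnique : QuasiUnique V x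
    x-quasiUnique = proj₂ (lostRepeat⇒quasiUniqueSuffix {V} {x} n ∣V∣≡1+n 1≤∣x∣ rep ¬rep′)
    end = length V ∸ length x
    early : a + c + length x ≤ n × OccursAt V x (a + c)
    early = occursAt-take⁻ {V} {x} (a + c) n 1≤∣x∣ (occursAt-trans {W} {w} a c 1≤∣x∣ w-in-W x-in-w)
    late : OccursAt V x end
    late = subst (λ y → OccursAt V y end) (sym x-suffix) (drop-occursAt end V)
    early<late : a + c < end
    early<late = m+n≤o⇒m≤o∸n (suc (a + c))
      (subst (suc (a + c + length x) ≤_) (sym ∣V∣≡1+n) (s≤s (proj₁ early)))
    conclude : (Σ ℕ λ k → 1 ≤ k × k ≤ length x × u ≡ suffix k x) → occ V u ≡ 2 × ProperSubstring u w
    conclude (k , 1≤k , k≤∣x∣ , refl) =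
      ≤-antisym u-atMostTwice (suffix-repeating k (a + c) end 1≤k k≤∣x∣ early<late (proj₂ early) late) ,
      suffix-properSubstring k c 1≤k k≤∣x∣ x-in-w ∣x∣<∣w∣

lemma5 : {A : Set} (_≟_ : DecidableEquality A) (T : List A) (i j : ℕ) →
    1 ≤ i → i ≤ j → j < length T →
    ∀ s t → Strings.InMUS _≟_ T i (suc j) s t → t ≢ suc j →
    ¬ Strings.InMUS _≟_ T i j s t →
    ∀ u → Strings.IsSqs _≟_ (Strings.sub _≟_ T i (suc j)) u →
    Strings.occ _≟_ (Strings.sub _≟_ T i (suc j)) u ≡ 2 ×
    Strings.ProperSubstring _≟_ u (Strings.sub _≟_ T s t)
lemma5 _≟_ T i j 1≤i i≤j j<∣T∣ s t (i≤s , s≤t , t≤1+j , w-unique , x₁-repeats , x₂-repeats)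
       t≢1+j notMUS u sqs =
  [ (λ x₁-repeatsInW → viaLostRepeat (s ∸ s) (sub-trimʳ T 1≤s s≤t t<∣T∣) x₂-repeats λ x₂-repeatsInW →
       notMUS (i≤s , s≤t , t≤j , w-uniqueInW , x₁-repeatsInW , x₂-repeatsInW))
  , viaLostRepeat (suc s ∸ s) (sub-trimˡ T 1≤s s≤t t<∣T∣) x₁-repeats
  ]′ (toSum (2 ≤? occ W (sub T (suc s) t)))
  where
  open Strings _≟_
  open Occurrences _≟_
  n = suc j ∸ i
  V = sub T i (suc j)
  W = sub T i j
  w = sub T s t
  1≤s : 1 ≤ s
  1≤s = ≤-trans 1≤i i≤s
  t≤j : t ≤ j
  t≤j = s≤s⁻¹ (≤∧≢⇒< t≤1+j t≢1+j)
  t<∣T∣ : t < length T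
  t<∣T∣ = ≤-<-trans t≤j j<∣T∣
  W≡ : W ≡ take n V
  W≡ = sub-prefix T i (n≤1+n j)
  w-in-W : OccursAt W w (s ∸ i)
  w-in-W = sub-occursAt T 1≤i i≤s (m≤n⇒m≤1+n s≤t) t≤j
  1≤∣w∣ : 1 ≤ length w
  1≤∣w∣ = subst (1 ≤_) (sym (length-sub T 1≤s (<⇒≤ t<∣T∣))) (m<n⇒0<n∸m (s≤s s≤t))
  w-uniqueInW : Unique W w
  w-uniqueInW = unique-prefix {V} {w = w} n (s ∸ i) 1≤∣w∣ W≡ w-in-W w-unique
  ∣V∣≡1+n : length V ≡ suc n
  ∣V∣≡1+n = trans (length-sub T 1≤i j<∣T∣) (+-∸-assoc 1 (m≤n⇒m≤1+n i≤j))
  viaLostRepeat : ∀ {x} c → OccursAt w x c × length x < length w →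
                  Repeating V x → ¬ Repeating W x → occ V u ≡ 2 × ProperSubstring u w
  viaLostRepeat c (x-in-w , ∣x∣<∣w∣) rep ¬rep′ =
    lostRepeat⇒sqs-twice-inside n (s ∸ i) c (m<n⇒0<n∸m (s≤s i≤j)) ∣V∣≡1+n W≡ w-in-W x-in-w ∣x∣<∣w∣
      rep ¬rep′ sqs
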